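{- For every finite simple graph $G$, $\delta(G)-1\le Z_f^+(G)$, where $\delta(G)$ is the minimum degree of $G$.
   Context: For $r\in\mathbb{N}$, the $r$-blowup $G^{(r)}$ is obtained by replacing each vertex $u$ of $G$ by an independent set $R_u$ of $r$ vertices and each edge $uw$ by all edges between $R_u$ and $R_w$. $r$-fold PSD forcing game: an initial set $B\subseteq V(G^{(r)})$ is blue, the rest white; at each step, with $B_t$ the current blue set and $W_1,\dots,W_h$ the vertex sets of the connected components of $G^{(r)}-B_t$, a vertex $u\in B_t$ with $|N(u)\cap W_i|\le r$ for some $i$ may color all of $N(u)\cap W_i$ blue. $Z_{(r)}^+(G)$ is the minimum cardinality of an initial blue set from which all of $G^{(r)}$ can be made blue, and $Z_f^+(G)=\inf_{r\in\mathbb{N}}Z_{(r)}^+(G)/r$. -}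

module Defs where

open import Data.Nat using (ℕ; zero; suc; _+_; _*_; _≤_; _⊓_)
open import Data.Bool using (Bool; true; false; if_then_else_)
open import Data.Fin using (Fin; zero; suc; quotient)
open import Data.Fin.Subset using (Subset; _∈_; _∉_; _∪_; ⊤; ∣_∣)
open import Data.Product using (Σ; _×_; ∃-syntax)
open import Relation.Binary.PropositionalEquality using (_≡_)
open import Relation.Binary.Construct.Closure.ReflexiveTransitive using (Star)

record SimpleGraph (n : ℕ) : Set where
  field
    adj    : Fin n → Fin n → Bool
    sym    : ∀ u v → adj u v ≡ adj v u
    irrefl : ∀ u → adj u u ≡ false
open SimpleGraph public

countTrue : ∀ {n} → (Fin n → Bool) → ℕ
countTrue {zero}  f = 0
countTrue {suc n} f = (if f zero then 1 else 0) + countTrue (λ i → f (suc i))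

degree : ∀ {n} → SimpleGraph n → Fin n → ℕ
degree G u = countTrue (adj G u)

minF : ∀ {n} → (Fin (suc n) → ℕ) → ℕ
minF {zero}  f = f zero
minF {suc n} f = f zero ⊓ minF (λ i → f (suc i))

minDeg : ∀ {n} → SimpleGraph (suc n) → ℕ
minDeg G = minF (degree G)

-- r-blowup G^(r): vertex x ∈ Fin (n * r) corresponds to the pair (quotient r x, remainder r x),
-- i.e. vertex (quotient r x) of G, copy (remainder r x);  x ~ y iff their G-vertices are adjacent.
blowupAdj : ∀ {n} → SimpleGraph n → (r : ℕ) → Fin (n * r) → Fin (n * r) → Bool
blowupAdj G r x y = adj G (quotient r x) (quotient r y)

-- Generic graphs on Fin N given by an adjacency function.
-- WhiteReach A B w x : x lies in the connected component of the white graph (A minus B) containing w.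
data WhiteReach {N : ℕ} (A : Fin N → Fin N → Bool) (B : Subset N) (w : Fin N) : Fin N → Set where
  here : w ∉ B → WhiteReach A B w w
  step : ∀ {y z} → WhiteReach A B w y → A y z ≡ true → z ∉ B → WhiteReach A B w z

-- One r-fold PSD forcing step: a blue vertex u and a white component W (the one containing w)
-- with |N(u) ∩ W| ≤ r; all of N(u) ∩ W becomes blue.
data ForceStep {N : ℕ} (r : ℕ) (A : Fin N → Fin N → Bool) (B : Subset N) : Subset N → Set where
  force : (u w : Fin N) → u ∈ B → w ∉ B →
          (S : Subset N) →
          (∀ x → x ∈ S → (A u x ≡ true × WhiteReach A B w x)) →
          (∀ x → A u x ≡ true → WhiteReach A B w x → x ∈ S) →
          ∣ S ∣ ≤ r →
          ForceStep r A B (B ∪ S)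

IsForcingSet : ∀ {N : ℕ} (r : ℕ) (A : Fin N → Fin N → Bool) (B : Subset N) → Set
IsForcingSet r A B = Star (ForceStep r A) B ⊤

-- Follow the forcing process from B.  While it runs, every white component W has at most ∣B∣
-- blue neighbours: after a force from u into W, a new component meeting the forced set
-- S = N(u) ∩ W lies inside W, and its at most r neighbours in S can be traded for the r twins
-- of u, which are blue and border W but not the new component.  The process must therefore
-- reach a force after which no vertex is white, or S is nonempty and a twin u' of u is still
-- white.  Then some z ∈ W (z = w, resp. z = u') has all its white neighbours in S, so
-- δ r ≤ deg z ≤ ∣B∣ + r.
module Submission where

open import Defs hiding (sym)
open import Data.Nat using (ℕ; zero; suc; _+_; _*_; _∸_; _≤_; z≤n; s≤s)
open import Data.Nat.Properties
  using (≤-refl; ≤-trans; ≤-reflexive; m≤n⇒m≤1+n; m≤m+n; m⊓n≤m; m⊓n≤n; +-suc; +-assoc;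
         +-comm; +-identityʳ; *-zeroʳ; *-suc; *-distribʳ-+; +-mono-≤; +-monoˡ-≤; *-monoˡ-≤;
         +-cancelʳ-≤; module ≤-Reasoning)
open import Data.Bool using (Bool; true; false; if_then_else_; _∧_; _∨_; not)
open import Data.Bool.Properties using () renaming (_≟_ to _≟ᵇ_)
open import Data.Fin using (Fin; zero; suc; quotient; _↑ˡ_; _↑ʳ_)
open import Data.Fin.Properties using (_≟_; any?; splitAt-↑ˡ; splitAt-↑ʳ)
open import Data.Fin.Subset using (Subset; _∈_; _∉_; _⊆_; _∪_; ⊤; ∣_∣)
open import Data.Fin.Subset.Properties using (_∈?_; ∈⊤; ∣⊤∣≡n; p⊆q⇒∣p∣≤∣q∣; x∈p∪q⁻; p⊆p∪q; q⊆p∪q)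
open import Data.Vec using ([]; _∷_; lookup)
open import Data.Vec.Properties using ([]=⇒lookup; lookup⇒[]=)
open import Data.Product using (_×_; _,_; proj₁; proj₂; ∃-syntax)
open import Data.Sum using (_⊎_; inj₁; inj₂; [_,_])
open import Data.Empty using (⊥; ⊥-elim)
open import Function using (_∘_)
open import Relation.Nullary using (Dec; yes; no; does; ¬?; _×-dec_)
open import Relation.Binary.PropositionalEquality
  using (_≡_; refl; sym; trans; cong; cong₂; subst; module ≡-Reasoning)
open import Relation.Binary.Construct.Closure.ReflexiveTransitive using (Star; ε; _◅_)

∧-true : ∀ {a b} → a ∧ b ≡ true → a ≡ true × b ≡ true
∧-true {true} {true} _ = refl , refl

∨-true : ∀ {a b} → a ∨ b ≡ true → a ≡ true ⊎ b ≡ true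
∨-true {true} _ = inj₁ refl
∨-true {false} e = inj₂ e

does-true : ∀ {a} {A : Set a} (a? : Dec A) → does a? ≡ true → A
does-true (yes a) _ = a

not-lookup⇒∉ : ∀ {N} {p : Subset N} {x} → not (lookup p x) ≡ true → x ∉ p
not-lookup⇒∉ ¬px x∈p with () ← trans (cong not (sym ([]=⇒lookup x∈p))) ¬px

countTrue-cong : ∀ {N} {f g : Fin N → Bool} → (∀ i → f i ≡ g i) → countTrue f ≡ countTrue g
countTrue-cong {zero} _ = refl
countTrue-cong {suc N} f≗g rewrite f≗g zero = cong (_ +_) (countTrue-cong (f≗g ∘ suc))

countTrue-mono : ∀ {N} {f g : Fin N → Bool} → (∀ i → f i ≡ true → g i ≡ true) →
                 countTrue f ≤ countTrue g
countTrue-mono {zero} _ = z≤n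
countTrue-mono {suc N} {f} {g} f⇒g with f zero in f₀ | g zero in g₀
... | true  | true  = s≤s (countTrue-mono (f⇒g ∘ suc))
... | true  | false with () ← trans (sym (f⇒g zero f₀)) g₀
... | false | true  = m≤n⇒m≤1+n (countTrue-mono (f⇒g ∘ suc))
... | false | false = countTrue-mono (f⇒g ∘ suc)

countTrue≤ : ∀ {N} (f : Fin N → Bool) → countTrue f ≤ N
countTrue≤ {zero} _ = z≤n
countTrue≤ {suc N} f with f zero
... | true  = s≤s (countTrue≤ (f ∘ suc))
... | false = m≤n⇒m≤1+n (countTrue≤ (f ∘ suc))

countTrue-split : ∀ {N} (f g : Fin N → Bool) →
  countTrue f ≡ countTrue (λ i → f i ∧ g i) + countTrue (λ i → f i ∧ not (g i))
countTrue-split {zero} _ _ = refl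
countTrue-split {suc N} f g with f zero | g zero
... | true  | true  = cong suc (countTrue-split (f ∘ suc) (g ∘ suc))
... | true  | false = trans (cong suc (countTrue-split (f ∘ suc) (g ∘ suc))) (sym (+-suc _ _))
... | false | _     = countTrue-split (f ∘ suc) (g ∘ suc)

countTrue-∨-disjoint : ∀ {N} (f g : Fin N → Bool) → (∀ i → f i ≡ true → g i ≡ true → ⊥) →
  countTrue (λ i → f i ∨ g i) ≡ countTrue f + countTrue g
countTrue-∨-disjoint {zero} _ _ _ = refl
countTrue-∨-disjoint {suc N} f g disjoint with f zero in f₀ | g zero in g₀
... | true  | true  = ⊥-elim (disjoint zero f₀ g₀)
... | true  | false = cong suc (countTrue-∨-disjoint (f ∘ suc) (g ∘ suc) (disjoint ∘ suc))
... | false | true  = trans (cong suc (countTrue-∨-disjoint (f ∘ suc) (g ∘ suc) (disjoint ∘ suc)))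
                           (sym (+-suc _ _))
... | false | false = countTrue-∨-disjoint (f ∘ suc) (g ∘ suc) (disjoint ∘ suc)

countTrue-const : ∀ N b → countTrue {N} (λ _ → b) ≡ (if b then 1 else 0) * N
countTrue-const zero b = sym (*-zeroʳ (if b then 1 else 0))
countTrue-const (suc N) b =
  trans (cong (_ +_) (countTrue-const N b)) (sym (*-suc (if b then 1 else 0) N))

countTrue-↑ : ∀ a b (f : Fin (a + b) → Bool) →
  countTrue f ≡ countTrue (λ i → f (i ↑ˡ b)) + countTrue (λ j → f (a ↑ʳ j))
countTrue-↑ zero b f = refl
countTrue-↑ (suc a) b f =
  trans (cong ((if f zero then 1 else 0) +_) (countTrue-↑ a b (f ∘ suc)))
        (sym (+-assoc (if f zero then 1 else 0) _ _))

countTrue-≟ : ∀ {m} (c : Fin m) → countTrue (λ d → does (d ≟ c)) ≡ 1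
countTrue-≟ {suc m} zero = cong suc (countTrue-const m false)
countTrue-≟ (suc c) = countTrue-≟ c

countTrue-quotient : ∀ m r (h : Fin m → Bool) →
  countTrue {m * r} (h ∘ quotient r) ≡ countTrue h * r
countTrue-quotient zero r h = refl
countTrue-quotient (suc m) r h = begin
  countTrue {suc m * r} (h ∘ quotient r)
    ≡⟨ countTrue-↑ r (m * r) _ ⟩
  countTrue (λ i → h (quotient {suc m} r (i ↑ˡ (m * r))))
    + countTrue (λ j → h (quotient {suc m} r (r ↑ʳ j)))
    ≡⟨ cong₂ _+_ (countTrue-cong (λ i → cong h (quotient-↑ˡ i)))
                 (countTrue-cong (λ j → cong h (quotient-↑ʳ j))) ⟩
  countTrue {r} (λ _ → h zero) + countTrue {m * r} (h ∘ suc ∘ quotient {m} r)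
    ≡⟨ cong₂ _+_ (countTrue-const r (h zero)) (countTrue-quotient m r (h ∘ suc)) ⟩
  (if h zero then 1 else 0) * r + countTrue (h ∘ suc) * r
    ≡⟨ *-distribʳ-+ r (if h zero then 1 else 0) _ ⟨
  countTrue h * r ∎
  where
  open ≡-Reasoning
  quotient-↑ˡ : ∀ i → quotient {suc m} r (i ↑ˡ (m * r)) ≡ zero
  quotient-↑ˡ i rewrite splitAt-↑ˡ r i (m * r) = refl
  quotient-↑ʳ : ∀ j → quotient {suc m} r (r ↑ʳ j) ≡ suc (quotient {m} r j)
  quotient-↑ʳ j rewrite splitAt-↑ʳ r (m * r) j = refl

countTrue-lookup : ∀ {N} (p : Subset N) → countTrue (lookup p) ≡ ∣ p ∣
countTrue-lookup [] = refl
countTrue-lookup (true ∷ p) = cong suc (countTrue-lookup p)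
countTrue-lookup (false ∷ p) = countTrue-lookup p

countTrue≤∣p∣ : ∀ {N} (f : Fin N → Bool) {p : Subset N} → (∀ i → f i ≡ true → i ∈ p) →
                countTrue f ≤ ∣ p ∣
countTrue≤∣p∣ f {p} f⊆p =
  ≤-trans (countTrue-mono (λ i → []=⇒lookup ∘ f⊆p i)) (≤-reflexive (countTrue-lookup p))

module _ {N : ℕ} {A : Fin N → Fin N → Bool} where

  WhiteReach-white : ∀ {B w x} → WhiteReach A B w x → x ∉ B
  WhiteReach-white (here w∉B) = w∉B
  WhiteReach-white (step _ _ x∉B) = x∉B

  WhiteReach-antimono : ∀ {B₀ B₁ w x} → B₀ ⊆ B₁ → WhiteReach A B₁ w x → WhiteReach A B₀ w x
  WhiteReach-antimono B₀⊆B₁ (here w∉B₁) = here (w∉B₁ ∘ B₀⊆B₁)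
  WhiteReach-antimono B₀⊆B₁ (step p a x∉B₁) = step (WhiteReach-antimono B₀⊆B₁ p) a (x∉B₁ ∘ B₀⊆B₁)

  WhiteReach-trans : ∀ {B w y z} → WhiteReach A B w y → WhiteReach A B y z → WhiteReach A B w z
  WhiteReach-trans p (here _) = p
  WhiteReach-trans p (step q a z∉B) = step (WhiteReach-trans p q) a z∉B

  WhiteReach-sym : (∀ x y → A x y ≡ A y x) →
                   ∀ {B w x} → WhiteReach A B w x → WhiteReach A B x w
  WhiteReach-sym A-sym (here w∉B) = here w∉B
  WhiteReach-sym A-sym (step {y} {z} p a z∉B) =
    WhiteReach-trans (step (here z∉B) (trans (A-sym z y) a) (WhiteReach-white p))
                     (WhiteReach-sym A-sym p)

-- Graphs whose vertices are grouped by q into classes of pairwise twins with at least r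
-- members each; the r-blowup of a graph with adjacency a is the case q = quotient r.
module Twins {m : ℕ} (a : Fin m → Fin m → Bool) (a-sym : ∀ c d → a c d ≡ a d c)
             {N : ℕ} (q : Fin N → Fin m) (r : ℕ)
             (class-size : ∀ c → r ≤ countTrue (λ x → does (q x ≟ c))) where

  A : Fin N → Fin N → Bool
  A x y = a (q x) (q y)

  A-sym : ∀ x y → A x y ≡ A y x
  A-sym x y = a-sym (q x) (q y)

  twin-adj : ∀ {u v} x → q v ≡ q u → A v x ≡ A u x
  twin-adj x qv≡qu = cong (λ c → a c (q x)) qv≡qu

  Boundary : Subset N → Fin N → Fin N → Set
  Boundary B w v = v ∈ B × ∃[ x ] (WhiteReach A B w x × A v x ≡ true)

  -- The boundary of a component need not be decidable, so its size is bounded through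
  -- every Boolean predicate contained in it.
  BoundaryBound : ℕ → Subset N → Set
  BoundaryBound K B = ∀ {w} → w ∉ B → (t : Fin N → Bool) →
                      (∀ v → t v ≡ true → Boundary B w v) → countTrue t ≤ K

  boundaryBound-initial : ∀ B → BoundaryBound ∣ B ∣ B
  boundaryBound-initial B _ t t⊆∂ = countTrue≤∣p∣ t (λ v → proj₁ ∘ t⊆∂ v)

  degree≤boundary+r : ∀ {K B S w z} → BoundaryBound K B → w ∉ B → WhiteReach A B w z →
                      (∀ y → A z y ≡ true → y ∉ B → y ∈ S) → ∣ S ∣ ≤ r →
                      countTrue (A z) ≤ K + r
  degree≤boundary+r {K} {B} {S} {w} {z} bound w∉B w~z white-nbrs⊆S ∣S∣≤r = begin
    countTrue (A z)
      ≡⟨ countTrue-split (A z) (lookup B) ⟩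
    countTrue (λ y → A z y ∧ lookup B y) + countTrue (λ y → A z y ∧ not (lookup B y))
      ≤⟨ +-mono-≤ (bound w∉B _ blue-nbr∈∂) (≤-trans (countTrue≤∣p∣ _ white-nbr∈S) ∣S∣≤r) ⟩
    K + r ∎
    where
    open ≤-Reasoning
    blue-nbr∈∂ : ∀ y → A z y ∧ lookup B y ≡ true → Boundary B w y
    blue-nbr∈∂ y e with zy , y∈B ← ∧-true e = lookup⇒[]= y B y∈B , z , w~z , trans (A-sym y z) zy
    white-nbr∈S : ∀ y → A z y ∧ not (lookup B y) ≡ true → y ∈ S
    white-nbr∈S y e with zy , y∉B ← ∧-true e = white-nbrs⊆S y zy (not-lookup⇒∉ y∉B)

  module _ {B S : Subset N} {u w : Fin N} (w∉B : w ∉ B)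
           (S⊆N[u]∩W : ∀ x → x ∈ S → A u x ≡ true × WhiteReach A B w x)
           (N[u]∩W⊆S : ∀ x → A u x ≡ true → WhiteReach A B w x → x ∈ S)
           (∣S∣≤r : ∣ S ∣ ≤ r) where

    private
      shrink : ∀ {w' x} → WhiteReach A (B ∪ S) w' x → WhiteReach A B w' x
      shrink = WhiteReach-antimono (p⊆p∪q S)

    component⊆W : ∀ {w' v₀} → v₀ ∈ S → Boundary (B ∪ S) w' v₀ →
                  ∀ {x} → WhiteReach A (B ∪ S) w' x → WhiteReach A B w x
    component⊆W v₀∈S (_ , x₀ , w'~x₀ , v₀x₀) w'~x =
      WhiteReach-trans (WhiteReach-trans w~x₀ (WhiteReach-sym A-sym (shrink w'~x₀))) (shrink w'~x)
      where
      w~x₀ : WhiteReach A B w x₀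
      w~x₀ = step (proj₂ (S⊆N[u]∩W _ v₀∈S)) v₀x₀ (WhiteReach-white (shrink w'~x₀))

    boundaryBound-avoiding : ∀ {K w'} → BoundaryBound K B → w' ∉ B ∪ S → (t : Fin N → Bool) →
      (∀ v → t v ≡ true → Boundary (B ∪ S) w' v) → (∀ v → t v ≡ true → v ∉ S) →
      countTrue t ≤ K
    boundaryBound-avoiding bound w'∉ t t⊆∂ t∩S≡∅ = bound (w'∉ ∘ p⊆p∪q S) t t⊆∂B
      where
      t⊆∂B : ∀ v → t v ≡ true → Boundary _ _ v
      t⊆∂B v tv with v∈B∪S , x , w'~x , vx ← t⊆∂ v tv with x∈p∪q⁻ B S v∈B∪S
      ... | inj₁ v∈B = v∈B , x , shrink w'~x , vx
      ... | inj₂ v∈S = ⊥-elim (t∩S≡∅ v tv v∈S)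

    boundaryBound-meeting : ∀ {K w' v₀} → BoundaryBound K B → (∀ v → q v ≡ q u → v ∈ B) →
      (t : Fin N → Bool) → (∀ v → t v ≡ true → Boundary (B ∪ S) w' v) →
      t v₀ ≡ true → v₀ ∈ S → countTrue t ≤ K
    boundaryBound-meeting {K} bound twins-blue t t⊆∂ tv₀ v₀∈S = begin
      countTrue t
        ≡⟨ countTrue-split t (lookup S) ⟩
      countTrue (λ v → t v ∧ lookup S v) + countTrue t∖S
        ≤⟨ +-monoˡ-≤ _ (≤-trans (countTrue≤∣p∣ _ (λ v → lookup⇒[]= v S ∘ proj₂ ∘ ∧-true)) ∣S∣≤r) ⟩
      r + countTrue t∖S
        ≤⟨ +-monoˡ-≤ _ (class-size (q u)) ⟩
      countTrue twin + countTrue t∖S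
        ≡⟨ countTrue-∨-disjoint twin t∖S disjoint ⟨
      countTrue (λ v → twin v ∨ t∖S v)
        ≤⟨ bound w∉B _ (λ v → [ twin⊆∂W , t∖S⊆∂W ] ∘ ∨-true) ⟩
      K ∎
      where
      open ≤-Reasoning
      twin t∖S : Fin N → Bool
      twin v = does (q v ≟ q u)
      t∖S v = t v ∧ not (lookup S v)
      W'⊆W = component⊆W v₀∈S (t⊆∂ _ tv₀)
      twin⊆∂W : ∀ {v} → twin v ≡ true → Boundary B w v
      twin⊆∂W {v} e with qv≡qu ← does-true (q v ≟ q u) e with A-u-v₀ , w~v₀ ← S⊆N[u]∩W _ v₀∈S =
        twins-blue v qv≡qu , _ , w~v₀ , trans (twin-adj _ qv≡qu) A-u-v₀
      t∖S⊆∂W : ∀ {v} → t∖S v ≡ true → Boundary B w v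
      t∖S⊆∂W {v} e with tv , v∉S ← ∧-true e with v∈B∪S , x , w'~x , vx ← t⊆∂ v tv
        with x∈p∪q⁻ B S v∈B∪S
      ... | inj₁ v∈B = v∈B , x , W'⊆W w'~x , vx
      ... | inj₂ v∈S = ⊥-elim (not-lookup⇒∉ v∉S v∈S)
      -- A twin of u next to the new component would force its neighbour there into S.
      disjoint : ∀ v → twin v ≡ true → t∖S v ≡ true → ⊥
      disjoint v e e' with qv≡qu ← does-true (q v ≟ q u) e with tv , _ ← ∧-true e'
        with _ , x , w'~x , vx ← t⊆∂ v tv =
        WhiteReach-white w'~x
          (q⊆p∪q B S (N[u]∩W⊆S x (trans (sym (twin-adj x qv≡qu)) vx) (W'⊆W w'~x)))

    boundaryBound-force : ∀ {K} → (∀ x → x ∈ S → ∀ v → q v ≡ q u → v ∈ B) →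
                          BoundaryBound K B → BoundaryBound K (B ∪ S)
    boundaryBound-force twins-blue bound w'∉ t t⊆∂
      with any? (λ v → (t v ≟ᵇ true) ×-dec (v ∈? S))
    ... | yes (v₀ , tv₀ , v₀∈S) = boundaryBound-meeting bound (twins-blue v₀ v₀∈S) t t⊆∂ tv₀ v₀∈S
    ... | no t∩S≢∅ = boundaryBound-avoiding bound w'∉ t t⊆∂ (λ v tv v∈S → t∩S≢∅ (v , tv , v∈S))

  forcing⇒low-degree : ∀ {K B w} → Star (ForceStep r A) B ⊤ → BoundaryBound K B → w ∉ B →
                       ∃[ z ] countTrue (A z) ≤ K + r
  forcing⇒low-degree ε _ w∉⊤ = ⊥-elim (w∉⊤ ∈⊤)
  forcing⇒low-degree {B = B} (force u w _ w∉B S S⊆N[u]∩W N[u]∩W⊆S ∣S∣≤r ◅ rest) bound _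
    with any? (λ y → ¬? (y ∈? B ∪ S))
  ... | no B∪S-full = w , degree≤boundary+r bound w∉B (here w∉B) white⊆S ∣S∣≤r
    where
    white⊆S : ∀ y → A w y ≡ true → y ∉ B → y ∈ S
    white⊆S y _ y∉B with y ∈? B ∪ S
    ... | no y∉B∪S = ⊥-elim (B∪S-full (y , y∉B∪S))
    ... | yes y∈B∪S with x∈p∪q⁻ B S y∈B∪S
    ...   | inj₁ y∈B = ⊥-elim (y∉B y∈B)
    ...   | inj₂ y∈S = y∈S
  ... | yes (y , y∉B∪S)
    with any? (λ x → x ∈? S) | any? (λ v → (q v ≟ q u) ×-dec ¬? (v ∈? B))
  ...   | yes (x , x∈S) | yes (v , qv≡qu , v∉B) =
    v , degree≤boundary+r bound w∉B w~v white-nbr⊆S ∣S∣≤r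
    where
    w~v : WhiteReach A B w v
    w~v = step (proj₂ (S⊆N[u]∩W x x∈S))
               (trans (A-sym x v) (trans (twin-adj x qv≡qu) (proj₁ (S⊆N[u]∩W x x∈S)))) v∉B
    white-nbr⊆S : ∀ y → A v y ≡ true → y ∉ B → y ∈ S
    white-nbr⊆S y vy y∉B = N[u]∩W⊆S y (trans (sym (twin-adj y qv≡qu)) vy) (step w~v vy y∉B)
  ...   | no S≡∅ | _ =
    forcing⇒low-degree rest (boundaryBound-force w∉B S⊆N[u]∩W N[u]∩W⊆S ∣S∣≤r
                               (λ x x∈S → ⊥-elim (S≡∅ (x , x∈S))) bound) y∉B∪S
  ...   | yes _ | no no-white-twin =
    forcing⇒low-degree rest (boundaryBound-force w∉B S⊆N[u]∩W N[u]∩W⊆S ∣S∣≤r twins-blue bound)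
                       y∉B∪S
    where
    twins-blue : ∀ x → x ∈ S → ∀ v → q v ≡ q u → v ∈ B
    twins-blue _ _ v qv≡qu with v ∈? B
    ... | yes v∈B = v∈B
    ... | no v∉B = ⊥-elim (no-white-twin (v , qv≡qu , v∉B))

  forcingSet⇒low-degree : ∀ {B w} → IsForcingSet r A B → w ∉ B →
                          ∃[ z ] countTrue (A z) ≤ ∣ B ∣ + r
  forcingSet⇒low-degree {B} forcing = forcing⇒low-degree forcing (boundaryBound-initial B)

minF≤ : ∀ {n} (f : Fin (suc n) → ℕ) i → minF f ≤ f i
minF≤ {zero} f zero = ≤-refl
minF≤ {suc n} f zero = m⊓n≤m _ _
minF≤ {suc n} f (suc i) = ≤-trans (m⊓n≤n _ _) (minF≤ (f ∘ suc) i)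

blowup-class-size : ∀ {m} r (c : Fin m) → countTrue (λ x → does (quotient {m} r x ≟ c)) ≡ r
blowup-class-size {m} r c =
  trans (countTrue-quotient m r (λ d → does (d ≟ c)))
        (trans (cong (_* r) (countTrue-≟ c)) (+-identityʳ r))

minDeg*r≤blowup-degree : ∀ {n} (G : SimpleGraph (suc n)) r z →
                         minDeg G * r ≤ countTrue (blowupAdj G r z)
minDeg*r≤blowup-degree {n} G r z =
  ≤-trans (*-monoˡ-≤ r (minF≤ (degree G) (quotient r z)))
          (≤-reflexive (sym (countTrue-quotient (suc n) r (adj G (quotient r z)))))

m*r≤k+r⇒[m∸1]*r≤k : ∀ m r k → m * r ≤ k + r → (m ∸ 1) * r ≤ k
m*r≤k+r⇒[m∸1]*r≤k zero r k _ = z≤n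
m*r≤k+r⇒[m∸1]*r≤k (suc m) r k h = +-cancelʳ-≤ r (m * r) k (subst (_≤ k + r) (+-comm r (m * r)) h)

corollary2p29 : (n : ℕ) (G : SimpleGraph (suc n)) (r : ℕ) → 1 ≤ r →
                (B : Subset (suc n * r)) → IsForcingSet r (blowupAdj G r) B →
                (minDeg G ∸ 1) * r ≤ ∣ B ∣
corollary2p29 n G r _ B forcing = m*r≤k+r⇒[m∸1]*r≤k (minDeg G) r ∣ B ∣ δr≤∣B∣+r
  where
  open ≤-Reasoning
  δr≤∣B∣+r : minDeg G * r ≤ ∣ B ∣ + r
  δr≤∣B∣+r with any? (λ x → ¬? (x ∈? B))
  ... | yes (_ , w∉B) with z , deg≤ ← Twins.forcingSet⇒low-degree (adj G) (SimpleGraph.sym G)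
                                        (quotient r) r (≤-reflexive ∘ sym ∘ blowup-class-size r)
                                        forcing w∉B =
    ≤-trans (minDeg*r≤blowup-degree G r z) deg≤
  ... | no all-blue = begin
    minDeg G * r    ≤⟨ *-monoˡ-≤ r (≤-trans (minF≤ (degree G) zero) (countTrue≤ (adj G zero))) ⟩
    suc n * r       ≡⟨ ∣⊤∣≡n (suc n * r) ⟨
    ∣ ⊤ {suc n * r} ∣ ≤⟨ p⊆q⇒∣p∣≤∣q∣ ⊤⊆B ⟩
    ∣ B ∣           ≤⟨ m≤m+n ∣ B ∣ r ⟩
    ∣ B ∣ + r       ∎
    where
    ⊤⊆B : ⊤ ⊆ B
    ⊤⊆B {x} _ with x ∈? B
    ... | yes x∈B = x∈B
    ... | no x∉B = ⊥-elim (all-blue (x , x∉B))
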